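{- Let $G$ be a graph of order $n\geq 3$ and let $\overline{G}$ be its complement. Then (1) $$0\leq \mathrm{mp}(G)+\mathrm{mp}(\overline{G})\leq \begin{cases} n-1 & \text{if $n$ is even},\\ 2n-3 & \text{if $n$ is odd};\end{cases}$$ (2) $$0\leq \mathrm{mp}(G)\cdot \mathrm{mp}(\overline{G})\leq \begin{cases} \lceil\frac{n-1}{2}\rceil\lfloor\frac{n-1}{2}\rfloor & \text{if $n$ is even},\\ (n-2)^2 & \text{if $n$ is odd and $n\geq 5$}.\end{cases}$$
   Context: All graphs are finite, simple and undirected; $\overline{G}$ is the complement of $G$. A perfect matching is a set of edges covering every vertex exactly once; an almost-perfect matching is a set of edges covering every vertex except one exactly once and missing the remaining vertex. The matching preclusion number $\mathrm{mp}(G)$ is the minimum number of edges whose deletion leaves a graph with neither a perfect matching nor an almost-perfect matching ($\mathrm{mp}(G)=0$ if $G$ has neither). -}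

module Defs where

open import Data.Nat using (ℕ; zero; suc; _+_; _<ᵇ_; _≤_)
open import Data.Fin using (Fin; toℕ)
open import Data.Bool using (Bool; true; false; _∧_; not; if_then_else_)
open import Data.Product using (Σ; _×_; ∃)
open import Relation.Nullary using (¬_; Dec; yes; no)
open import Relation.Binary.PropositionalEquality using (_≡_)
open import Data.Fin using (_≟_)

record Graph (n : ℕ) : Set where
  field
    adj   : Fin n → Fin n → Bool
    adjSym : ∀ i j → adj i j ≡ adj j i
    irref : ∀ i → adj i i ≡ false
open Graph public

sumFin : (n : ℕ) → (Fin n → ℕ) → ℕ
sumFin zero    f = 0
sumFin (suc n) f = f Fin.zero + sumFin n (λ i → f (Fin.suc i))

adjC : ∀ {n} → Graph n → Fin n → Fin n → Bool
adjC G i j with i ≟ j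
... | yes _ = false
... | no  _ = not (adj G i j)

record EdgeSubset {n : ℕ} (G : Graph n) : Set where
  field
    mem   : Fin n → Fin n → Bool
    msym  : ∀ i j → mem i j ≡ mem j i
    msub  : ∀ i j → mem i j ≡ true → adj G i j ≡ true
open EdgeSubset public

edgeCount : ∀ {n} {G : Graph n} → EdgeSubset G → ℕ
edgeCount {n} F =
  sumFin n (λ i → sumFin n (λ j → if (toℕ i <ᵇ toℕ j) ∧ mem F i j then 1 else 0))

adjDel : ∀ {n} (G : Graph n) → EdgeSubset G → Fin n → Fin n → Bool
adjDel G F i j = adj G i j ∧ not (mem F i j)

record Matching {n : ℕ} (H : Fin n → Fin n → Bool) : Set where
  field
    medge : Fin n → Fin n → Bool
    esym  : ∀ i j → medge i j ≡ medge j i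
    esub  : ∀ i j → medge i j ≡ true → H i j ≡ true
    atMostOne : ∀ v u w → medge v u ≡ true → medge v w ≡ true → u ≡ w
open Matching public

Covered : ∀ {n} {H : Fin n → Fin n → Bool} → Matching H → Fin n → Set
Covered M v = ∃ λ u → medge M v u ≡ true

IsPerfect : ∀ {n} {H : Fin n → Fin n → Bool} → Matching H → Set
IsPerfect {n} M = ∀ (v : Fin n) → Covered M v

IsAlmostPerfect : ∀ {n} {H : Fin n → Fin n → Bool} → Matching H → Set
IsAlmostPerfect {n} M =
  Σ (Fin n) λ v₀ → ¬ Covered M v₀ × (∀ v → ¬ v ≡ v₀ → Covered M v)

HasPM : ∀ {n} → (Fin n → Fin n → Bool) → Set
HasPM H = Σ (Matching H) IsPerfect

HasAPM : ∀ {n} → (Fin n → Fin n → Bool) → Set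
HasAPM H = Σ (Matching H) IsAlmostPerfect

IsPreclusion : ∀ {n} (G : Graph n) → EdgeSubset G → Set
IsPreclusion G F = ¬ HasPM (adjDel G F) × ¬ HasAPM (adjDel G F)

-- mp(G) = k : k is the minimum size of a matching preclusion set.
-- (k = 0 exactly when G itself has neither a PM nor an APM.)
MP : ∀ {n} → Graph n → ℕ → Set
MP G k =
  (Σ (EdgeSubset G) λ F → IsPreclusion G F × edgeCount F ≡ k) ×
  (∀ (F : EdgeSubset G) → IsPreclusion G F → k ≤ edgeCount F)

complement : ∀ {n} → Graph n → Graph n
complement {n} G = record { adj = adjC G ; adjSym = s ; irref = r }
  where
    open import Relation.Binary.PropositionalEquality using (refl; sym; cong)
    s : ∀ i j → adjC G i j ≡ adjC G j i
    s i j with i ≟ j | j ≟ i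
    ... | yes _ | yes _ = refl
    ... | yes p | no q  = Data.Empty.⊥-elim (q (sym p)) where import Data.Empty
    ... | no p  | yes q = Data.Empty.⊥-elim (p (sym q)) where import Data.Empty
    ... | no _  | no _  = cong not (Graph.adjSym G i j)
    r : ∀ i → adjC G i i ≡ false
    r i with i ≟ i
    ... | yes _ = refl
    ... | no p  = Data.Empty.⊥-elim (p refl) where import Data.Empty

module Submission where

-- Everything rests on two counting facts about the edge set star(P) of all
-- edges with an end in a vertex set P: deleting it leaves the vertices of P
-- isolated, and |star{u}| = deg u, |star{u,v}| = deg u + deg v − [uv ∈ E].
-- With the parity of |V| forced by perfect (|V| even) and almost-perfect
-- (|V| odd) matchings, this gives mp(G) ≤ deg u for even n and
-- mp(G) + [uv ∈ E] ≤ deg u + deg v for odd n.  Adding the same bounds for the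
-- complement, where deg u + deg' u = n − 1, yields the sum bounds n − 1 and
-- 2n − 3; the even product bound follows from AM–GM.  For odd n the product
-- bound also follows from AM–GM unless a + b = 2n − 3; then every pair bound is
-- an equality, summing it over a vertex shows G is regular (n ≥ 4), so G or its
-- complement is edgeless and one factor is 0.

open import Defs
open import Data.Nat using (ℕ; zero; suc; _+_; _*_; _∸_; _≤_; _<_; _<ᵇ_; _%_; _≤?_; ⌊_/2⌋; ⌈_/2⌉; z≤n; s≤s; s≤s⁻¹)
open import Data.Nat.Properties hiding (_≟_)
open import Data.Nat.DivMod using (m*n%n≡0; [m+kn]%n≡m%n)
open import Data.Nat.Tactic.RingSolver using (solve-∀)
open import Data.Fin using (Fin; zero; suc; toℕ; _≟_; punchIn)
import Data.Fin as Fin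
open import Data.Fin.Properties using (toℕ-injective; punchInᵢ≢i)
open import Data.Bool using (Bool; true; false; _∧_; _∨_; not; if_then_else_)
open import Data.Bool.Properties using (∨-comm; ∨-zeroʳ)
open import Data.Product using (_×_; _,_)
open import Data.Sum using (_⊎_; inj₁; inj₂)
import Data.Sum
open import Data.Empty using (⊥; ⊥-elim)
open import Function using (_∘_)
open import Relation.Nullary using (¬_; does; yes; no; ofʸ; ofⁿ)
open import Relation.Nullary.Decidable using (dec-true)
open import Relation.Binary.PropositionalEquality
open import Algebra.Properties.Semiring.Sum +-*-semiring
  using (sum; sum-syntax; sum-remove; sum-cong-≗; ∑-distrib-+; ∑-comm; *-distribˡ-sum)
open ≡-Reasoning

sumFin≡sum : ∀ n (f : Fin n → ℕ) → sumFin n f ≡ sum f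
sumFin≡sum zero    f = refl
sumFin≡sum (suc n) f = cong (f zero +_) (sumFin≡sum n (f ∘ suc))

∑-const : ∀ n c → ∑[ i < n ] c ≡ n * c
∑-const zero    c = refl
∑-const (suc n) c = cong (c +_) (∑-const n c)

∑-count : ∀ n → ∑[ i < n ] 1 ≡ n
∑-count n = trans (∑-const n 1) (*-identityʳ n)

∑-supported : ∀ {n} (t : Fin n → ℕ) (u : Fin n) → (∀ j → j ≢ u → t j ≡ 0) → sum t ≡ t u
∑-supported {suc n} t u vanish = begin
  sum t                          ≡⟨ sum-remove t ⟩
  t u + ∑[ j < n ] t (punchIn u j) ≡⟨ cong (t u +_) (sum-cong-≗ (λ j → vanish _ (punchInᵢ≢i u j))) ⟩
  t u + ∑[ j < n ] 0             ≡⟨ cong (t u +_) (trans (∑-const n 0) (*-zeroʳ n)) ⟩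
  t u + 0                        ≡⟨ +-identityʳ (t u) ⟩
  t u                            ∎

𝟙 : Bool → ℕ
𝟙 b = if b then 1 else 0

𝟙-injective : ∀ {b c} → 𝟙 b ≡ 𝟙 c → b ≡ c
𝟙-injective {true}  {true}  _ = refl
𝟙-injective {false} {false} _ = refl

⟦_⟧ : ∀ {n} → Fin n → Fin n → Bool
⟦ u ⟧ i = does (i ≟ u)

infixr 6 _∪_
_∪_ : ∀ {n} → (Fin n → Bool) → (Fin n → Bool) → Fin n → Bool
(P ∪ Q) i = P i ∨ Q i

∑∈ : ∀ {n} → (Fin n → Bool) → (Fin n → ℕ) → ℕ
∑∈ {n} P g = ∑[ i < n ] (𝟙 (P i) * g i)
syntax ∑∈ P (λ i → x) = ∑[ i ∈ P ] x

∑-single : ∀ {n} (u : Fin n) (g : Fin n → ℕ) → ∑[ i ∈ ⟦ u ⟧ ] g i ≡ g u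
∑-single u g = begin
  ∑[ i ∈ ⟦ u ⟧ ] g i  ≡⟨ ∑-supported (λ i → 𝟙 (⟦ u ⟧ i) * g i) u off-u ⟩
  𝟙 (⟦ u ⟧ u) * g u   ≡⟨ cong (λ b → 𝟙 b * g u) (dec-true (u ≟ u) refl) ⟩
  1 * g u             ≡⟨ *-identityˡ (g u) ⟩
  g u                 ∎
  where
  off-u : ∀ j → j ≢ u → 𝟙 (⟦ u ⟧ j) * g j ≡ 0
  off-u j j≢u with j ≟ u
  ... | yes j≡u = ⊥-elim (j≢u j≡u)
  ... | no  _   = refl

∑-pair : ∀ {n} {u v : Fin n} → u ≢ v → (g : Fin n → ℕ) → ∑[ i ∈ ⟦ u ⟧ ∪ ⟦ v ⟧ ] g i ≡ g u + g v
∑-pair {n} {u} {v} u≢v g = begin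
  ∑[ i ∈ ⟦ u ⟧ ∪ ⟦ v ⟧ ] g i                           ≡⟨ sum-cong-≗ {n} split ⟩
  ∑[ i < n ] (𝟙 (⟦ u ⟧ i) * g i + 𝟙 (⟦ v ⟧ i) * g i)   ≡⟨ ∑-distrib-+ (λ i → 𝟙 (⟦ u ⟧ i) * g i) _ ⟩
  ∑[ i ∈ ⟦ u ⟧ ] g i + ∑[ i ∈ ⟦ v ⟧ ] g i              ≡⟨ cong₂ _+_ (∑-single u g) (∑-single v g) ⟩
  g u + g v                                           ∎
  where
  split : ∀ i → 𝟙 ((⟦ u ⟧ ∪ ⟦ v ⟧) i) * g i ≡ 𝟙 (⟦ u ⟧ i) * g i + 𝟙 (⟦ v ⟧ i) * g i
  split i with i ≟ u | i ≟ v
  ... | yes refl | yes refl = ⊥-elim (u≢v refl)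
  ... | yes _    | no  _    = sym (+-identityʳ _)
  ... | no  _    | yes _    = refl
  ... | no  _    | no  _    = refl

∑∑ : ∀ {n} → (Fin n → Fin n → ℕ) → ℕ
∑∑ {n} f = ∑[ i < n ] ∑[ j < n ] f i j

∑∑-+ : ∀ {n} (f g : Fin n → Fin n → ℕ) → ∑∑ (λ i j → f i j + g i j) ≡ ∑∑ f + ∑∑ g
∑∑-+ f g = trans (sum-cong-≗ (λ i → ∑-distrib-+ (f i) (g i)))
                 (∑-distrib-+ (λ i → sum (f i)) (λ i → sum (g i)))

Symmetric Irreflexive : ∀ {n} → (Fin n → Fin n → Bool) → Set
Symmetric   m = ∀ i j → m i j ≡ m j i
Irreflexive m = ∀ i → m i i ≡ false

⊆-irr : ∀ {n} {H m : Fin n → Fin n → Bool} → Irreflexive H →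
        (∀ i j → m i j ≡ true → H i j ≡ true) → Irreflexive m
⊆-irr {m = m} H-irr m⊆H i with m i i in ii∈m
... | true  with () ← trans (sym (m⊆H i i ii∈m)) (H-irr i)
... | false = refl

pairs : ∀ {n} → (Fin n → Fin n → Bool) → ℕ
pairs m = ∑∑ (λ i j → 𝟙 (m i j))

infix 7 _≺_
_≺_ : ∀ {n} → Fin n → Fin n → Bool
i ≺ j = toℕ i <ᵇ toℕ j

edges : ∀ {n} → (Fin n → Fin n → Bool) → ℕ
edges m = ∑∑ (λ i j → 𝟙 (i ≺ j ∧ m i j))

edgeCount≡edges : ∀ {n} {G : Graph n} (F : EdgeSubset G) → edgeCount F ≡ edges (mem F)
edgeCount≡edges {n} F = trans (sumFin≡sum n _) (sum-cong-≗ {n} (λ i → sumFin≡sum n _))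

handshake : ∀ {n} (m : Fin n → Fin n → Bool) → Symmetric m → Irreflexive m → pairs m ≡ 2 * edges m
handshake {n} m m-sym m-irr = begin
  pairs m                                             ≡⟨ sum-cong-≗ {n} (λ i → sum-cong-≗ {n} (orient i)) ⟩
  ∑∑ (λ i j → 𝟙 (i ≺ j ∧ m i j) + 𝟙 (j ≺ i ∧ m i j)) ≡⟨ ∑∑-+ (λ i j → 𝟙 (i ≺ j ∧ m i j)) _ ⟩
  edges m + ∑∑ (λ i j → 𝟙 (j ≺ i ∧ m i j))            ≡⟨ cong (edges m +_) (∑-comm {n} {n} _) ⟩
  edges m + ∑∑ (λ j i → 𝟙 (j ≺ i ∧ m i j))            ≡⟨ cong (edges m +_) (sum-cong-≗ {n} λ j → sum-cong-≗ {n} λ i →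
                                                           cong (λ b → 𝟙 (j ≺ i ∧ b)) (m-sym i j)) ⟩
  edges m + edges m                                   ≡⟨ cong (edges m +_) (sym (+-identityʳ _)) ⟩
  2 * edges m                                         ∎
  where
  -- each related pair is oriented exactly one way, the diagonal being empty
  orient : ∀ i j → 𝟙 (m i j) ≡ 𝟙 (i ≺ j ∧ m i j) + 𝟙 (j ≺ i ∧ m i j)
  orient i j with i ≺ j | <ᵇ-reflects-< (toℕ i) (toℕ j) | j ≺ i | <ᵇ-reflects-< (toℕ j) (toℕ i)
  ... | true  | ofʸ i<j | true  | ofʸ j<i = ⊥-elim (<-asym i<j j<i)
  ... | true  | _       | false | _       = sym (+-identityʳ _)
  ... | false | _       | true  | _       = refl
  ... | false | ofⁿ i≮j | false | ofⁿ j≮i = trans (cong (λ k → 𝟙 (m i k)) (sym i≡j)) (cong 𝟙 (m-irr i))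
    where i≡j = toℕ-injective (≤-antisym (≮⇒≥ j≮i) (≮⇒≥ i≮j))

-- Matchings force the parity of the order

double-even : ∀ k → (2 * k) % 2 ≡ 0
double-even k = trans (cong (_% 2) (*-comm 2 k)) (m*n%n≡0 k 2)

double-odd : ∀ k → (1 + 2 * k) % 2 ≡ 1
double-odd k = trans (cong (λ x → (1 + x) % 2) (*-comm 2 k)) ([m+kn]%n≡m%n 1 k 2)

parity-clash : ∀ n → n % 2 ≡ 0 → n % 2 ≡ 1 → ⊥
parity-clash n even odd with () ← trans (sym even) odd

-- Counting the vertices covered by a matching M: each has exactly one M-edge,
-- so there are 2|M| of them.
module MatchingParity {n} {H : Fin n → Fin n → Bool} (H-irr : Irreflexive H) (M : Matching H) where

  degM : Fin n → ℕ
  degM v = ∑[ j < n ] 𝟙 (medge M v j)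

  covered⇒degM≡1 : ∀ {v} → Covered M v → degM v ≡ 1
  covered⇒degM≡1 {v} (u , vu∈M) = trans (∑-supported (λ j → 𝟙 (medge M v j)) u only-u) (cong 𝟙 vu∈M)
    where
    only-u : ∀ j → j ≢ u → 𝟙 (medge M v j) ≡ 0
    only-u j j≢u with medge M v j in vj∈M
    ... | true  = ⊥-elim (j≢u (atMostOne M v j u vj∈M vu∈M))
    ... | false = refl

  uncovered⇒degM≡0 : ∀ {v} → ¬ Covered M v → degM v ≡ 0
  uncovered⇒degM≡0 {v} uncovered = trans (sum-cong-≗ {n} no-edge) (trans (∑-const n 0) (*-zeroʳ n))
    where
    no-edge : ∀ j → 𝟙 (medge M v j) ≡ 0
    no-edge j with medge M v j in vj∈M
    ... | true  = ⊥-elim (uncovered (j , vj∈M))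
    ... | false = refl

  ∑degM : ∑[ v < n ] degM v ≡ 2 * edges (medge M)
  ∑degM = handshake (medge M) (esym M) (⊆-irr H-irr (esub M))

  perfect⇒even : IsPerfect M → n % 2 ≡ 0
  perfect⇒even perfect = trans (cong (_% 2) count) (double-even (edges (medge M)))
    where
    count : n ≡ 2 * edges (medge M)
    count = begin
      n                   ≡⟨ sym (∑-count n) ⟩
      ∑[ v < n ] 1        ≡⟨ sum-cong-≗ {n} (λ v → sym (covered⇒degM≡1 (perfect v))) ⟩
      ∑[ v < n ] degM v   ≡⟨ ∑degM ⟩
      2 * edges (medge M) ∎

  almostPerfect⇒odd : IsAlmostPerfect M → n % 2 ≡ 1
  almostPerfect⇒odd (v₀ , v₀-uncovered , others-covered) =
    trans (cong (_% 2) count) (double-odd (edges (medge M)))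
    where
    one : ∀ v → 1 ≡ 𝟙 (⟦ v₀ ⟧ v) * 1 + degM v
    one v with v ≟ v₀
    ... | yes refl = cong suc (sym (uncovered⇒degM≡0 v₀-uncovered))
    ... | no  v≢v₀ = sym (covered⇒degM≡1 (others-covered v v≢v₀))
    count : n ≡ 1 + 2 * edges (medge M)
    count = begin
      n                                       ≡⟨ sym (∑-count n) ⟩
      ∑[ v < n ] 1                            ≡⟨ sum-cong-≗ {n} one ⟩
      ∑[ v < n ] (𝟙 (⟦ v₀ ⟧ v) * 1 + degM v)  ≡⟨ ∑-distrib-+ (λ v → 𝟙 (⟦ v₀ ⟧ v) * 1) degM ⟩
      ∑[ v ∈ ⟦ v₀ ⟧ ] 1 + ∑[ v < n ] degM v   ≡⟨ cong₂ _+_ (∑-single {n} v₀ (λ _ → 1)) ∑degM ⟩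
      1 + 2 * edges (medge M)                 ∎

open MatchingParity using (perfect⇒even; almostPerfect⇒odd)

deg : ∀ {n} → Graph n → Fin n → ℕ
deg {n} G u = ∑[ j < n ] 𝟙 (adj G u j)

star : ∀ {n} (G : Graph n) → (Fin n → Bool) → EdgeSubset G
star G P = record { mem = λ i j → adj G i j ∧ (P i ∨ P j) ; msym = star-sym ; msub = star-sub }
  where
  star-sym : ∀ i j → adj G i j ∧ (P i ∨ P j) ≡ adj G j i ∧ (P j ∨ P i)
  star-sym i j = cong₂ _∧_ (adjSym G i j) (∨-comm (P i) (P j))
  star-sub : ∀ i j → adj G i j ∧ (P i ∨ P j) ≡ true → adj G i j ≡ true
  star-sub i j ij∈F with adj G i j
  ... | true  = refl
  ... | false = ij∈F

adjDel-irr : ∀ {n} (G : Graph n) (F : EdgeSubset G) → Irreflexive (adjDel G F)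
adjDel-irr G F i rewrite irref G i = refl

star-isolates : ∀ {n} (G : Graph n) (P : Fin n → Bool) {u} → P u ≡ true →
                (M : Matching (adjDel G (star G P))) → ¬ Covered M u
star-isolates G P {u} u∈P M (w , uw∈M) = not-left (esub M u w uw∈M)
  where
  not-left : adj G u w ∧ not (adj G u w ∧ (P u ∨ P w)) ≢ true
  not-left rewrite u∈P with adj G u w
  ... | true  = λ ()
  ... | false = λ ()

inclusion-exclusion : ∀ a p q → 𝟙 (a ∧ (p ∨ q)) + 𝟙 p * (𝟙 q * 𝟙 a) ≡ 𝟙 p * 𝟙 a + 𝟙 q * 𝟙 a
inclusion-exclusion true  true  true  = refl
inclusion-exclusion true  true  false = refl
inclusion-exclusion true  false true  = refl
inclusion-exclusion true  false false = refl
inclusion-exclusion false true  true  = refl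
inclusion-exclusion false true  false = refl
inclusion-exclusion false false true  = refl
inclusion-exclusion false false false = refl

star-count : ∀ {n} (G : Graph n) (P : Fin n → Bool) →
             2 * edges (mem (star G P)) + ∑[ i ∈ P ] ∑[ j ∈ P ] 𝟙 (adj G i j) ≡ 2 * ∑[ i ∈ P ] deg G i
star-count {n} G P = begin
  2 * edges (mem (star G P)) + ∑[ i ∈ P ] ∑[ j ∈ P ] a i j
    ≡⟨ cong₂ _+_ (sym (handshake (mem (star G P)) (msym (star G P)) (⊆-irr (irref G) (msub (star G P)))))
                 (sum-cong-≗ {n} λ i → *-distribˡ-sum (𝟙 (P i)) (λ j → 𝟙 (P j) * a i j)) ⟩
  pairs (mem (star G P)) + ∑∑ (λ i j → 𝟙 (P i) * (𝟙 (P j) * a i j))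
    ≡⟨ sym (∑∑-+ (λ i j → 𝟙 (adj G i j ∧ (P i ∨ P j))) _) ⟩
  ∑∑ (λ i j → 𝟙 (adj G i j ∧ (P i ∨ P j)) + 𝟙 (P i) * (𝟙 (P j) * a i j))
    ≡⟨ sum-cong-≗ {n} (λ i → sum-cong-≗ {n} λ j → inclusion-exclusion (adj G i j) (P i) (P j)) ⟩
  ∑∑ (λ i j → 𝟙 (P i) * a i j + 𝟙 (P j) * a i j)
    ≡⟨ ∑∑-+ (λ i j → 𝟙 (P i) * a i j) _ ⟩
  ∑∑ (λ i j → 𝟙 (P i) * a i j) + ∑∑ (λ i j → 𝟙 (P j) * a i j)
    ≡⟨ cong (∑∑ (λ i j → 𝟙 (P i) * a i j) +_) (∑-comm {n} {n} _) ⟩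
  ∑∑ (λ i j → 𝟙 (P i) * a i j) + ∑∑ (λ j i → 𝟙 (P j) * a i j)
    ≡⟨ cong (∑∑ (λ i j → 𝟙 (P i) * a i j) +_)
            (sum-cong-≗ {n} λ j → sum-cong-≗ {n} λ i → cong (λ b → 𝟙 (P j) * 𝟙 b) (adjSym G i j)) ⟩
  ∑∑ (λ i j → 𝟙 (P i) * a i j) + ∑∑ (λ i j → 𝟙 (P i) * a i j)
    ≡⟨ cong₂ _+_ volume volume ⟩
  vol + vol
    ≡⟨ cong (vol +_) (sym (+-identityʳ vol)) ⟩
  2 * vol ∎
  where
  a : Fin n → Fin n → ℕ
  a i j = 𝟙 (adj G i j)
  vol : ℕ
  vol = ∑[ i ∈ P ] deg G i
  volume : ∑∑ (λ i j → 𝟙 (P i) * a i j) ≡ vol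
  volume = sum-cong-≗ {n} λ i → sym (*-distribˡ-sum (𝟙 (P i)) (a i))

star-single : ∀ {n} (G : Graph n) (u : Fin n) → edges (mem (star G ⟦ u ⟧)) ≡ deg G u
star-single {n} G u = *-cancelˡ-≡ _ _ 2 (begin
  2 * E                                                ≡⟨ sym (+-identityʳ _) ⟩
  2 * E + 0                                            ≡⟨ cong (2 * E +_) (sym no-loop) ⟩
  2 * E + ∑[ i ∈ ⟦ u ⟧ ] ∑[ j ∈ ⟦ u ⟧ ] 𝟙 (adj G i j)  ≡⟨ star-count G ⟦ u ⟧ ⟩
  2 * ∑[ i ∈ ⟦ u ⟧ ] deg G i                          ≡⟨ cong (2 *_) (∑-single u (deg G)) ⟩
  2 * deg G u                                          ∎)
  where
  E = edges (mem (star G ⟦ u ⟧))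
  no-loop : ∑[ i ∈ ⟦ u ⟧ ] ∑[ j ∈ ⟦ u ⟧ ] 𝟙 (adj G i j) ≡ 0
  no-loop = trans (∑-single u _) (trans (∑-single u _) (cong 𝟙 (irref G u)))

star-pair : ∀ {n} (G : Graph n) {u v : Fin n} → u ≢ v →
            edges (mem (star G (⟦ u ⟧ ∪ ⟦ v ⟧))) + 𝟙 (adj G u v) ≡ deg G u + deg G v
star-pair {n} G {u} {v} u≢v = *-cancelˡ-≡ _ _ 2 (begin
  2 * (E + e)                                 ≡⟨ *-distribˡ-+ 2 E e ⟩
  2 * E + 2 * e                               ≡⟨ cong (2 * E +_) (sym inner-edge) ⟩
  2 * E + ∑[ i ∈ P ] ∑[ j ∈ P ] 𝟙 (adj G i j) ≡⟨ star-count G P ⟩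
  2 * ∑[ i ∈ P ] deg G i                      ≡⟨ cong (2 *_) (∑-pair u≢v (deg G)) ⟩
  2 * (deg G u + deg G v)                     ∎)
  where
  P = ⟦ u ⟧ ∪ ⟦ v ⟧
  E = edges (mem (star G P))
  e = 𝟙 (adj G u v)
  -- the only edge inside {u, v} is uv itself, seen from both ends
  inner-edge : ∑[ i ∈ P ] ∑[ j ∈ P ] 𝟙 (adj G i j) ≡ 2 * e
  inner-edge = begin
    ∑[ i ∈ P ] ∑[ j ∈ P ] 𝟙 (adj G i j)                ≡⟨ sum-cong-≗ {n} (λ i → cong (𝟙 (P i) *_) (∑-pair u≢v _)) ⟩
    ∑[ i ∈ P ] (𝟙 (adj G i u) + 𝟙 (adj G i v))          ≡⟨ ∑-pair u≢v _ ⟩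
    𝟙 (adj G u u) + e + (𝟙 (adj G v u) + 𝟙 (adj G v v)) ≡⟨ cong₂ (λ x y → 𝟙 x + e + (𝟙 y + 𝟙 (adj G v v)))
                                                               (irref G u) (adjSym G v u) ⟩
    e + (e + 𝟙 (adj G v v))                            ≡⟨ cong (λ x → e + (e + 𝟙 x)) (irref G v) ⟩
    2 * e                                              ∎

-- Degree bounds on the matching preclusion number

module _ {n} (G : Graph n) where

  -- n even: isolating one vertex kills perfect matchings; parity kills the others.
  isolate-one : n % 2 ≡ 0 → (u : Fin n) → IsPreclusion G (star G ⟦ u ⟧)
  isolate-one even u = no-pm , no-apm
    where
    no-pm : ¬ HasPM (adjDel G (star G ⟦ u ⟧))
    no-pm (M , perfect) = star-isolates G ⟦ u ⟧ (dec-true (u ≟ u) refl) M (perfect u)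
    no-apm : ¬ HasAPM (adjDel G (star G ⟦ u ⟧))
    no-apm (M , almost) = parity-clash n even (almostPerfect⇒odd (adjDel-irr G (star G ⟦ u ⟧)) M almost)

  -- n odd: two isolated vertices kill almost-perfect matchings; parity kills perfect ones.
  isolate-two : n % 2 ≡ 1 → {u v : Fin n} → u ≢ v → IsPreclusion G (star G (⟦ u ⟧ ∪ ⟦ v ⟧))
  isolate-two odd {u} {v} u≢v = no-pm , no-apm
    where
    P = ⟦ u ⟧ ∪ ⟦ v ⟧
    u∈P : P u ≡ true
    u∈P = cong (_∨ ⟦ v ⟧ u) (dec-true (u ≟ u) refl)
    v∈P : P v ≡ true
    v∈P = trans (cong (⟦ u ⟧ v ∨_) (dec-true (v ≟ v) refl)) (∨-zeroʳ (⟦ u ⟧ v))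
    no-pm : ¬ HasPM (adjDel G (star G P))
    no-pm (M , perfect) = parity-clash n (perfect⇒even (adjDel-irr G (star G P)) M perfect) odd
    no-apm : ¬ HasAPM (adjDel G (star G P))
    no-apm (M , v₀ , _ , others-covered) with v₀ ≟ u
    ... | yes refl = star-isolates G P v∈P M (others-covered v (u≢v ∘ sym))
    ... | no  v₀≢u = star-isolates G P u∈P M (others-covered u (v₀≢u ∘ sym))

  mp≤deg : ∀ {a} → MP G a → n % 2 ≡ 0 → (u : Fin n) → a ≤ deg G u
  mp≤deg {a} (_ , minimal) even u =
    subst (a ≤_) (trans (edgeCount≡edges F) (star-single G u)) (minimal F (isolate-one even u))
    where F = star G ⟦ u ⟧

  mp≤deg₂ : ∀ {a} → MP G a → n % 2 ≡ 1 → {u v : Fin n} → u ≢ v →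
            a + 𝟙 (adj G u v) ≤ deg G u + deg G v
  mp≤deg₂ {a} (_ , minimal) odd {u} {v} u≢v =
    subst (a + 𝟙 (adj G u v) ≤_) (trans (cong (_+ 𝟙 (adj G u v)) (edgeCount≡edges F)) (star-pair G u≢v))
          (+-monoˡ-≤ (𝟙 (adj G u v)) (minimal F (isolate-two odd u≢v)))
    where F = star G (⟦ u ⟧ ∪ ⟦ v ⟧)

adjC-distinct : ∀ {n} (G : Graph n) {u v : Fin n} → u ≢ v → adjC G u v ≡ not (adj G u v)
adjC-distinct G {u} {v} u≢v with u ≟ v
... | yes u≡v = ⊥-elim (u≢v u≡v)
... | no  _   = refl

complement-edge : ∀ {n} (G : Graph n) {u v : Fin n} → u ≢ v → 𝟙 (adj G u v) + 𝟙 (adjC G u v) ≡ 1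
complement-edge G {u} {v} u≢v rewrite adjC-distinct G u≢v with adj G u v
... | true  = refl
... | false = refl

deg-complement : ∀ {n} (G : Graph n) (u : Fin n) → deg G u + deg (complement G) u + 1 ≡ n
deg-complement {n} G u = begin
  deg G u + deg (complement G) u + 1                     ≡⟨ cong (deg G u + deg (complement G) u +_) (sym (∑-single u (λ _ → 1))) ⟩
  ∑[ j < n ] a j + ∑[ j < n ] c j + ∑[ j < n ] (δ j * 1) ≡⟨ cong (_+ ∑[ j < n ] (δ j * 1)) (sym (∑-distrib-+ a c)) ⟩
  ∑[ j < n ] (a j + c j) + ∑[ j < n ] (δ j * 1)          ≡⟨ sym (∑-distrib-+ (λ j → a j + c j) (λ j → δ j * 1)) ⟩
  ∑[ j < n ] (a j + c j + δ j * 1)                       ≡⟨ sum-cong-≗ {n} exactly-one ⟩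
  ∑[ j < n ] 1                                           ≡⟨ ∑-count n ⟩
  n                                                      ∎
  where
  a c δ : Fin n → ℕ
  a j = 𝟙 (adj G u j)
  c j = 𝟙 (adjC G u j)
  δ j = 𝟙 (⟦ u ⟧ j)
  exactly-one : ∀ j → a j + c j + δ j * 1 ≡ 1
  exactly-one j with j ≟ u
  ... | yes refl = cong₂ (λ x y → 𝟙 x + 𝟙 y + 1) (irref G u) (irref (complement G) u)
  ... | no  j≢u  = trans (+-identityʳ _) (complement-edge G (j≢u ∘ sym))

Edgeless : ∀ {n} → Graph n → Set
Edgeless {n} H = ∀ {u v : Fin n} → u ≢ v → adj H u v ≡ false

edgeless⇒deg≡0 : ∀ {n} (H : Graph n) → Edgeless H → ∀ u → deg H u ≡ 0
edgeless⇒deg≡0 {n} H edgeless u = trans (sum-cong-≗ {n} no-edge) (trans (∑-const n 0) (*-zeroʳ n))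
  where
  no-edge : ∀ j → 𝟙 (adj H u j) ≡ 0
  no-edge j with u ≟ j
  ... | yes refl = cong 𝟙 (irref H u)
  ... | no  u≢j  = cong 𝟙 (edgeless u≢j)

edgeless⇒mp≡0 : ∀ {n} (H : Graph n) {c} → MP H c → n % 2 ≡ 1 → {u v : Fin n} → u ≢ v → Edgeless H → c ≡ 0
edgeless⇒mp≡0 H {c} mpH odd {u} {v} u≢v edgeless = n≤0⇒n≡0 (m+n≤o⇒m≤o c (≤-trans (mp≤deg₂ H mpH odd u≢v)
  (≤-reflexive (cong₂ _+_ (edgeless⇒deg≡0 H edgeless u) (edgeless⇒deg≡0 H edgeless v)))))

am-gm-ordered : ∀ {x y} → x ≤ y → 4 * (x * y) ≤ (x + y) * (x + y)
am-gm-ordered {x} x≤y with m≤n⇒∃[o]m+o≡n x≤y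
... | t , refl = subst (4 * (x * (x + t)) ≤_) (square-gap x t) (m≤m+n _ (t * t))
  where
  square-gap : ∀ x t → 4 * (x * (x + t)) + t * t ≡ (x + (x + t)) * (x + (x + t))
  square-gap = solve-∀

am-gm : ∀ x y → 4 * (x * y) ≤ (x + y) * (x + y)
am-gm x y with ≤-total x y
... | inj₁ x≤y = am-gm-ordered x≤y
... | inj₂ y≤x = subst₂ _≤_ (cong (4 *_) (*-comm y x)) (cong₂ _*_ (+-comm y x) (+-comm y x)) (am-gm-ordered y≤x)

⌈/2⌉-balanced : ∀ s → ⌈ s /2⌉ ≡ ⌊ s /2⌋ ⊎ ⌈ s /2⌉ ≡ suc ⌊ s /2⌋
⌈/2⌉-balanced zero          = inj₁ refl
⌈/2⌉-balanced (suc zero)    = inj₂ refl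
⌈/2⌉-balanced (suc (suc s)) = Data.Sum.map (cong suc) (cong suc) (⌈/2⌉-balanced s)

balanced-square : ∀ f {c} → c ≡ f ⊎ c ≡ suc f → (f + c) * (f + c) ≤ 4 * (c * f) + 1
balanced-square f (inj₁ refl) = subst (_≤ 4 * (f * f) + 1) (even-square f) (m≤m+n _ 1)
  where
  even-square : ∀ f → 4 * (f * f) ≡ (f + f) * (f + f)
  even-square = solve-∀
balanced-square f (inj₂ refl) = ≤-reflexive (odd-square f)
  where
  odd-square : ∀ f → (f + suc f) * (f + suc f) ≡ 4 * (suc f * f) + 1
  odd-square = solve-∀

quarter : ∀ p q → 4 * p ≤ 4 * q + 1 → p ≤ q
quarter p q 4p≤4q+1 =
  s≤s⁻¹ (*-cancelˡ-< 4 p (suc q) (≤-trans (s≤s 4p≤4q+1) (subst (suc (4 * q + 1) ≤_) (gap q) (m≤m+n _ 2))))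
  where
  gap : ∀ q → suc (4 * q + 1) + 2 ≡ 4 * suc q
  gap = solve-∀

product-bound : ∀ x y {s} → x + y ≤ s → x * y ≤ ⌈ s /2⌉ * ⌊ s /2⌋
product-bound x y {s} x+y≤s = quarter (x * y) (⌈ s /2⌉ * ⌊ s /2⌋)
  (≤-trans (am-gm x y) (≤-trans (*-mono-≤ x+y≤s x+y≤s)
    (subst (λ t → t * t ≤ 4 * (⌈ s /2⌉ * ⌊ s /2⌋) + 1) (⌊n/2⌋+⌈n/2⌉≡n s)
           (balanced-square ⌊ s /2⌋ (⌈/2⌉-balanced s)))))

-- n even: mp(G) + mp(Ḡ) ≤ deg u + deg' u = n − 1.
even-sum-bound : ∀ {n} (G : Graph n) {a b} → MP G a → MP (complement G) b → n % 2 ≡ 0 → Fin n →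
                 a + b ≤ n ∸ 1
even-sum-bound G mpG mpḠ even u = ≤-trans (+-mono-≤ (mp≤deg G mpG even u) (mp≤deg (complement G) mpḠ even u))
  (≤-reflexive (trans (sym (m+n∸n≡m _ 1)) (cong (_∸ 1) (deg-complement G u))))

edge-budget : ∀ {n} (G : Graph n) {u v : Fin n} → u ≢ v → ∀ x y →
              (x + 𝟙 (adj G u v)) + (y + 𝟙 (adjC G u v)) + 2 ≡ x + y + 3
edge-budget G {u} {v} u≢v x y = begin
  (x + e) + (y + ē) + 2   ≡⟨ regroup x y e ē ⟩
  x + y + (e + ē) + 2     ≡⟨ cong (λ t → x + y + t + 2) (complement-edge G u≢v) ⟩
  x + y + 1 + 2           ≡⟨ +-assoc (x + y) 1 2 ⟩
  x + y + 3               ∎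
  where
  e = 𝟙 (adj G u v)
  ē = 𝟙 (adjC G u v)
  regroup : ∀ x y e ē → (x + e) + (y + ē) + 2 ≡ x + y + (e + ē) + 2
  regroup = solve-∀

degree-budget : ∀ {n} (G : Graph n) (u v : Fin n) →
                (deg G u + deg G v) + (deg (complement G) u + deg (complement G) v) + 2 ≡ 2 * n
degree-budget {n} G u v = begin
  (d u + d v) + (d̄ u + d̄ v) + 2      ≡⟨ regroup (d u) (d v) (d̄ u) (d̄ v) ⟩
  (d u + d̄ u + 1) + (d v + d̄ v + 1)  ≡⟨ cong₂ _+_ (deg-complement G u) (deg-complement G v) ⟩
  n + n                              ≡⟨ cong (n +_) (sym (+-identityʳ n)) ⟩
  2 * n                              ∎
  where
  d d̄ : Fin n → ℕ
  d = deg G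
  d̄ = deg (complement G)
  regroup : ∀ p q p̄ q̄ → (p + q) + (p̄ + q̄) + 2 ≡ (p + p̄ + 1) + (q + q̄ + 1)
  regroup = solve-∀

≤-+-tight : ∀ {x y X Y} → x ≤ X → y ≤ Y → x + y ≡ X + Y → x ≡ X
≤-+-tight {x} {y} {X} {Y} x≤X y≤Y sum≡ =
  ≤-antisym x≤X (+-cancelʳ-≤ y X x (≤-trans (+-monoʳ-≤ X y≤Y) (≤-reflexive (sym sum≡))))

module OddOrder {n} (G : Graph n) {a b : ℕ} (mpG : MP G a) (mpḠ : MP (complement G) b) (odd : n % 2 ≡ 1) where

  -- n odd: (a + b + 1) + 2 ≤ (deg u + deg v) + (deg' u + deg' v) + 2 = 2n.
  odd-sum-bound : {u v : Fin n} → u ≢ v → a + b + 3 ≤ 2 * n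
  odd-sum-bound {u} {v} u≢v = subst₂ _≤_ (edge-budget G u≢v a b) (degree-budget G u v)
    (+-monoˡ-≤ 2 (+-mono-≤ (mp≤deg₂ G mpG odd u≢v) (mp≤deg₂ (complement G) mpḠ odd u≢v)))

  extremal⇒tight : a + b + 3 ≡ 2 * n → {u v : Fin n} → u ≢ v → a + 𝟙 (adj G u v) ≡ deg G u + deg G v
  extremal⇒tight extremal {u} {v} u≢v = ≤-+-tight (mp≤deg₂ G mpG odd u≢v) (mp≤deg₂ (complement G) mpḠ odd u≢v)
    (+-cancelʳ-≡ 2 _ _ (trans (edge-budget G u≢v a b) (trans extremal (sym (degree-budget G u v)))))

-- The extremal odd case: tight pair bounds force a regular, hence edgeless
-- or complete, graph (order n = 4 + k ≥ 4)

module Tight {k} (G : Graph (4 + k)) (a : ℕ)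
             (tight : ∀ {u v} → u ≢ v → a + 𝟙 (adj G u v) ≡ deg G u + deg G v) where

  degree-total : ℕ
  degree-total = ∑[ u < 4 + k ] deg G u

  -- Summing the tight identity over u ≠ v: (n − 3)·deg v + ∑ deg = (n − 1)·a.
  vertex-identity : ∀ v → (1 + k) * deg G v + degree-total ≡ (3 + k) * a
  vertex-identity v = rearrange k d degree-total a (begin
    degree-total + (4 + k) * d + a                         ≡⟨ cong₂ (λ x y → degree-total + x + y)
                                                                (sym (∑-const (4 + k) d)) (sym (∑-single v (λ _ → a))) ⟩
    degree-total + ∑[ u < 4 + k ] d + ∑[ u ∈ ⟦ v ⟧ ] a      ≡⟨ cong (_+ ∑[ u ∈ ⟦ v ⟧ ] a) (sym (∑-distrib-+ (deg G) (λ _ → d))) ⟩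
    ∑[ u < 4 + k ] (deg G u + d) + ∑[ u ∈ ⟦ v ⟧ ] a         ≡⟨ sym (∑-distrib-+ (λ u → deg G u + d) (λ u → 𝟙 (⟦ v ⟧ u) * a)) ⟩
    ∑[ u < 4 + k ] (deg G u + d + 𝟙 (⟦ v ⟧ u) * a)          ≡⟨ sum-cong-≗ {4 + k} pointwise ⟩
    ∑[ u < 4 + k ] (a + e u + 𝟙 (⟦ v ⟧ u) * (deg G u + d))  ≡⟨ ∑-distrib-+ (λ u → a + e u) (λ u → 𝟙 (⟦ v ⟧ u) * (deg G u + d)) ⟩
    ∑[ u < 4 + k ] (a + e u) + ∑[ u ∈ ⟦ v ⟧ ] (deg G u + d) ≡⟨ cong₂ _+_ (∑-distrib-+ (λ _ → a) e) (∑-single v (λ u → deg G u + d)) ⟩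
    ∑[ u < 4 + k ] a + ∑[ u < 4 + k ] e u + (d + d)         ≡⟨ cong₂ (λ x y → x + y + (d + d)) (∑-const (4 + k) a) column ⟩
    (4 + k) * a + d + (d + d)                              ∎)
    where
    d = deg G v
    e : Fin (4 + k) → ℕ
    e u = 𝟙 (adj G u v)
    column : ∑[ u < 4 + k ] e u ≡ d
    column = sum-cong-≗ {4 + k} λ u → cong 𝟙 (adjSym G u v)
    -- the tight identity for u ≠ v, padded with a trivial identity at u = v
    pointwise : ∀ u → deg G u + d + 𝟙 (⟦ v ⟧ u) * a ≡ a + e u + 𝟙 (⟦ v ⟧ u) * (deg G u + d)
    pointwise u with u ≟ v
    ... | yes refl = trans (+-comm (d + d) (a + 0))
                           (cong₂ (λ x y → a + x + y) (sym (cong 𝟙 (irref G v))) (sym (+-identityʳ (d + d))))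
    ... | no  u≢v  = cong (_+ 0) (sym (tight u≢v))
    rearrange : ∀ k d T a → T + (4 + k) * d + a ≡ (4 + k) * a + d + (d + d) → (1 + k) * d + T ≡ (3 + k) * a
    rearrange k d T a eq = +-cancelʳ-≡ (d + d + d + a) _ _ (trans (lhs k d T a) (trans eq (rhs k d a)))
      where
      lhs : ∀ k d T a → (1 + k) * d + T + (d + d + d + a) ≡ T + (4 + k) * d + a
      lhs = solve-∀
      rhs : ∀ k d a → (4 + k) * a + d + (d + d) ≡ (3 + k) * a + (d + d + d + a)
      rhs = solve-∀

  -- Since n − 3 > 0, the vertex identity makes all degrees equal.
  regular : ∀ v w → deg G v ≡ deg G w
  regular v w = *-cancelˡ-≡ _ _ (1 + k)
    (+-cancelʳ-≡ degree-total _ _ (trans (vertex-identity v) (sym (vertex-identity w))))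

  -- In a regular graph with tight pair bounds all distinct pairs look alike.
  uniform : ∀ {u v w x} → u ≢ v → w ≢ x → adj G u v ≡ adj G w x
  uniform {u} {v} {w} {x} u≢v w≢x = 𝟙-injective (+-cancelˡ-≡ a _ _ (begin
    a + 𝟙 (adj G u v)   ≡⟨ tight u≢v ⟩
    deg G u + deg G v   ≡⟨ cong₂ _+_ (regular u w) (regular v x) ⟩
    deg G w + deg G x   ≡⟨ sym (tight w≢x) ⟩
    a + 𝟙 (adj G w x)   ∎))

-- n odd: either a + b ≤ 2(n − 2) and AM–GM applies, or the sum bound is
-- attained and the extremal case gives a·b = 0.
odd-product : ∀ {n} (G : Graph n) {a b} → MP G a → MP (complement G) b → n % 2 ≡ 1 → 4 ≤ n →
              a * b ≤ (n ∸ 2) * (n ∸ 2)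
odd-product {n@(suc (suc (suc (suc k))))} G {a} {b} mpG mpḠ odd (s≤s (s≤s (s≤s (s≤s _)))) with a + b + 4 ≤? 2 * n
... | yes slack = subst₂ (λ p q → a * b ≤ p * q) (sym (n≡⌈n+n/2⌉ (2 + k))) (sym (n≡⌊n+n/2⌋ (2 + k)))
                    (product-bound a b (+-cancelʳ-≤ 4 (a + b) ((2 + k) + (2 + k)) (subst (a + b + 4 ≤_) (halve k) slack)))
  where
  halve : ∀ k → 2 * (4 + k) ≡ (2 + k) + (2 + k) + 4
  halve = solve-∀
... | no  no-slack = zero-product zero-factor
  where
  open OddOrder G mpG mpḠ odd
  0≢1 : Fin.zero ≢ Fin.suc Fin.zero
  0≢1 ()
  extremal : a + b + 3 ≡ 2 * n
  extremal = ≤-antisym (odd-sum-bound 0≢1) (s≤s⁻¹ (subst (2 * n <_) (+-suc (a + b) 3) (≰⇒> no-slack)))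
  open Tight G a (extremal⇒tight extremal)
  -- G is edgeless or complete, i.e. G or its complement is edgeless
  zero-factor : a ≡ 0 ⊎ b ≡ 0
  zero-factor with adj G Fin.zero (Fin.suc Fin.zero) in e₀₁
  ... | false = inj₁ (edgeless⇒mp≡0 G mpG odd 0≢1 λ x≢y → trans (uniform x≢y 0≢1) e₀₁)
  ... | true  = inj₂ (edgeless⇒mp≡0 (complement G) mpḠ odd 0≢1 λ x≢y →
                  trans (adjC-distinct G x≢y) (cong not (trans (uniform x≢y 0≢1) e₀₁)))
  zero-product : a ≡ 0 ⊎ b ≡ 0 → a * b ≤ (n ∸ 2) * (n ∸ 2)
  zero-product (inj₁ refl) = z≤n
  zero-product (inj₂ refl) = subst (_≤ (n ∸ 2) * (n ∸ 2)) (sym (*-zeroʳ a)) z≤n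

theorem5p1 : (n : ℕ) → 3 ≤ n → (G : Graph n) → (a b : ℕ) →
    MP G a → MP (complement G) b →
      (0 ≤ a + b
        × (n % 2 ≡ 0 → a + b ≤ n ∸ 1)
        × (n % 2 ≡ 1 → a + b ≤ 2 * n ∸ 3))
      × (0 ≤ a * b
        × (n % 2 ≡ 0 → a * b ≤ ⌈ n ∸ 1 /2⌉ * ⌊ n ∸ 1 /2⌋)
        × (n % 2 ≡ 1 → 5 ≤ n → a * b ≤ (n ∸ 2) * (n ∸ 2)))
theorem5p1 n@(suc (suc (suc _))) (s≤s (s≤s (s≤s _))) G a b mpG mpḠ =
  (z≤n , even-sum , odd-sum) , (z≤n , even-product , odd-product-bound)
  where
  even-sum : n % 2 ≡ 0 → a + b ≤ n ∸ 1
  even-sum even = even-sum-bound G mpG mpḠ even Fin.zero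
  odd-sum : n % 2 ≡ 1 → a + b ≤ 2 * n ∸ 3
  odd-sum odd = m+n≤o⇒m≤o∸n (a + b) (OddOrder.odd-sum-bound G mpG mpḠ odd {Fin.zero} {Fin.suc Fin.zero} λ ())
  even-product : n % 2 ≡ 0 → a * b ≤ ⌈ n ∸ 1 /2⌉ * ⌊ n ∸ 1 /2⌋
  even-product even = product-bound a b (even-sum even)
  odd-product-bound : n % 2 ≡ 1 → 5 ≤ n → a * b ≤ (n ∸ 2) * (n ∸ 2)
  odd-product-bound odd 5≤n = odd-product G mpG mpḠ odd (<⇒≤ 5≤n)
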